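{- Let $A$ be a setoid, $B$ a setoid family over $A$, and $w,w':W$. Then $w\approx_Ww'$ if and only if there are \[\alpha:\mathsf{n}\,w\approx_A\mathsf{n}\,w'\quad\text{and}\quad\phi:\prod_{b:B(\mathsf{n}w)}\mathsf{b}\,w\,b\approx_W\mathsf{b}\,w'\,(B_\alpha\,b).\]
   Context: Setting: intensional Martin-Löf type theory with $\Pi$-types and a universe $\mathsf{U}$ closed under $\Pi$ and containing intensional $\Sigma$-types, identity types, the unit type, W-types and dependent W-types; logic is propositions-as-types. A setoid $X$ is a tuple $(X_0,\approx_X,r_X,s_X,t_X)$ with $X_0:\mathsf{U}$, $\approx_X:X_0\to X_0\to\mathsf{U}$ and witnesses of reflexivity, symmetry, transitivity; $x:X$ means $x:X_0$. An extensional function $f:X\Rightarrow Y$ is $f_0:X_0\to Y_0$ with a proof of $\prod_{x,x'}x\approx x'\to f_0x\approx f_0x'$. A setoid family $B$ over a setoid $A$ gives a setoid $B\,a$ (underlying type $B_0a$) for $a:A$ and extensional transports $B_\alpha:B\,a\Rightarrow B\,a'$ for $\alpha:a\approx_Aa'$, functorial up to $\approx$, with $B_\alpha\approx B_{\alpha'}$ for all $\alpha,\alpha':a\approx a'$. Write $b\approx_\alpha b'$ for $B_\alpha b\approx b'$. $\mathrm{W}$ is the W-type on $A_0,B_0$ with constructor $\mathsf{sup}$, and $\mathsf{n}(\mathsf{sup}\,a\,f)\equiv a$, $\mathsf{b}(\mathsf{sup}\,a\,f)\equiv f$. $\mathcal{W}_B:\mathrm{W}\to\mathrm{W}\to\mathsf{U}$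 is the inductive family with single constructor $\mathsf{dsup}\,(w,w')\,\alpha\,\phi:\mathcal{W}_B\,w\,w'$ for $\alpha:\mathsf{n}w\approx_A\mathsf{n}w'$ and $\phi:\prod_{(b,b',\beta):\sum_{b,b'}b\approx_\alpha b'}\mathcal{W}_B(\mathsf{b}\,w\,b)(\mathsf{b}\,w'\,b')$. The setoid $W$ has underlying type $\sum_{w:\mathrm{W}}\mathcal{W}_B\,w\,w$ (we write $w:W$ for such a pair, suppressing the second component) and $(w,\_)\approx_W(w',\_):=\mathcal{W}_B\,w\,w'$. For $w:W$ and $b:B_0(\mathsf{n}w)$, $\mathsf{b}\,w\,b$ is again an element of $W$. -}

module Defs where

open import Level using (0ℓ)
open import Data.Product using (Σ; Σ-syntax; _,_; proj₁; proj₂)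
open import Relation.Binary.Bundles using (Setoid)
open import Function.Bundles using (Func)

-- Setoids are stdlib setoids with carrier and relation in Set (the universe U).
-- Extensional functions X ⇒ Y are stdlib  Func X Y  (underlying map + congruence).

record SetoidFamily (A : Setoid 0ℓ 0ℓ) : Set₁ where
  open Setoid A renaming (Carrier to A₀; _≈_ to _≈A_)
  field
    Fam : A₀ → Setoid 0ℓ 0ℓ
    tr  : ∀ {a a'} → a ≈A a' → Func (Fam a) (Fam a')
  B₀ : A₀ → Set
  B₀ a = Setoid.Carrier (Fam a)
  _≈[_]_ : ∀ {a} → B₀ a → B₀ a → Set
  _≈[_]_ {a} = Setoid._≈_ (Fam a)
  trf : ∀ {a a'} → a ≈A a' → B₀ a → B₀ a'
  trf α = Func.to (tr α)
  field
    tr-refl  : ∀ {a} (b : B₀ a) → Setoid._≈_ (Fam a) (trf (Setoid.refl A) b) b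
    tr-trans : ∀ {a a' a''} (α : a ≈A a') (α' : a' ≈A a'') (b : B₀ a)
               → Setoid._≈_ (Fam a'') (trf α' (trf α b)) (trf (Setoid.trans A α α') b)
    tr-irr   : ∀ {a a'} (α α' : a ≈A a') (b : B₀ a)
               → Setoid._≈_ (Fam a') (trf α b) (trf α' b)

module WSetoid (A : Setoid 0ℓ 0ℓ) (B : SetoidFamily A) where
  open Setoid A renaming (Carrier to A₀; _≈_ to _≈A_)
  open SetoidFamily B

  _≈⟨_⟩_ : ∀ {a a'} → B₀ a → a ≈A a' → B₀ a' → Set
  _≈⟨_⟩_ {a' = a'} b α b' = Setoid._≈_ (Fam a') (trf α b) b'

  data W : Set where
    sup : (a : A₀) → (B₀ a → W) → W

  n : W → A₀
  n (sup a f) = a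

  b : (w : W) → B₀ (n w) → W
  b (sup a f) = f

  data 𝒲 : W → W → Set where
    dsup : (w w' : W) (α : n w ≈A n w')
           (φ : (p : Σ[ x ∈ B₀ (n w) ] Σ[ x' ∈ B₀ (n w') ] (x ≈⟨ α ⟩ x'))
                → 𝒲 (b w (proj₁ p)) (b w' (proj₁ (proj₂ p))))
           → 𝒲 w w'

  -- underlying type of the setoid W
  W₀ : Set
  W₀ = Σ[ w ∈ W ] 𝒲 w w

  nW : W₀ → A₀
  nW (w , _) = n w

  _≈W_ : W₀ → W₀ → Set
  (w , _) ≈W (w' , _) = 𝒲 w w'

  bW : (w : W₀) → B₀ (nW w) → W₀
  bW (w , dsup .w .w α φ) x =
    b w x , φ (x , x , Setoid.trans (Fam (n w)) (tr-irr α (Setoid.refl A) x) (tr-refl x))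

module Submission where

-- The lemma replaces the
-- "all related pairs of labels" quantifier by the simpler quantifier over
-- labels x of w, compared with their transport trf α x.
--
-- Unfolding (𝒲-unfold) specialises the
-- children clause of dsup to the related pair (x , trf α x).  Folding
-- (𝒲-fold) goes back: for a related pair (x , x') we compose the given
-- equality of children at (x , trf α x) with the equality of the children of
-- w' at trf α x and x', which exists because w' is self-related (its
-- children respect ≈ on labels, 𝒲-branch-cong); the composition uses
-- transitivity of 𝒲 (𝒲-trans).  The theorem is then the W₀-level reading of
-- these two maps, obtained by exposing the self-relatedness witnesses.

open import Defs
open import Level using (0ℓ)
open import Data.Product using (Σ; Σ-syntax; _,_)
open import Relation.Binary.Bundles using (Setoid)
open import Function.Bundles using (_⇔_; mk⇔)

module WEquality (A : Setoid 0ℓ 0ℓ) (B : SetoidFamily A) where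
  open Setoid A using () renaming (_≈_ to _≈A_; refl to reflA; trans to transA)
  open SetoidFamily B
  open WSetoid A B

  -- Transport along any loop a ≈A a is the identity up to ≈, so every label
  -- is related to itself along a loop.
  tr-loop : ∀ {a} (α : a ≈A a) (x : B₀ a) → x ≈⟨ α ⟩ x
  tr-loop {a} α x = Setoid.trans (Fam a) (tr-irr α reflA x) (tr-refl x)

  -- 𝒲 is transitive: nodes compose by transitivity in A, and children are
  -- matched through the intermediate label trf α x, using functoriality of
  -- transport.
  𝒲-trans : ∀ {u v z} → 𝒲 u v → 𝒲 v z → 𝒲 u z
  𝒲-trans (dsup u v α φ) (dsup .v z β ψ) =
    dsup u z (transA α β) λ { (x , x'' , e) →
      𝒲-trans (φ (x , trf α x , Setoid.refl (Fam (n v))))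
              (ψ (trf α x , x'' , Setoid.trans (Fam (n z)) (tr-trans α β x) e)) }

  𝒲-branch-cong : ∀ {v} → 𝒲 v v
                → ∀ {x x'} → Setoid._≈_ (Fam (n v)) x x' → 𝒲 (b v x) (b v x')
  𝒲-branch-cong {v} (dsup .v .v β χ) {x} {x'} e =
    χ (x , x' , Setoid.trans (Fam (n v)) (tr-loop β x) e)

  Pointwise : W → W → Set
  Pointwise w w' = Σ[ α ∈ n w ≈A n w' ] ((x : B₀ (n w)) → 𝒲 (b w x) (b w' (trf α x)))

  𝒲-unfold : ∀ {w w'} → 𝒲 w w' → Pointwise w w'
  𝒲-unfold (dsup w w' α φ) = α , λ x → φ (x , trf α x , Setoid.refl (Fam (n w')))

  -- Folding needs w' to be self-related, to move from trf α x to any x'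
  -- related to x along α.
  𝒲-fold : ∀ {w w'} → 𝒲 w' w' → Pointwise w w' → 𝒲 w w'
  𝒲-fold {w} {w'} self (α , ψ) =
    dsup w w' α λ { (x , x' , e) → 𝒲-trans (ψ x) (𝒲-branch-cong self e) }

open WSetoid using (dsup)

lemma3p3 : (A : Setoid 0ℓ 0ℓ) (B : SetoidFamily A)
    → let open WSetoid A B
          open SetoidFamily B
      in (w w' : W₀)
    → (w ≈W w')
    ⇔ (Σ[ α ∈ Setoid._≈_ A (nW w) (nW w') ]
    ((x : B₀ (nW w)) → bW w x ≈W bW w' (trf α x)))
-- Exposing the witnesses as dsup makes bW w x reduce to the child b w x,
-- so both sides become the raw statements of 𝒲-unfold and 𝒲-fold.
lemma3p3 A B (w , dsup _ _ _ _) (w' , self'@(dsup _ _ _ _)) =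
  mk⇔ 𝒲-unfold (𝒲-fold self')
  where open WEquality A B
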